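{- Consider the game Slow Exact $k$-Nim $\text{Nim}^1_{3,=2}$: three piles, positions $x=(x_1,x_2,x_3)$ with $0\le x_1\le x_2\le x_3$, and by one move a player chooses exactly $2$ non-empty piles and removes exactly one token from each. Let $\mathcal{G}$ and $\mathcal{G}^-$ be the Sprague-Grundy functions of its normal and misère versions. Call $x$ a swap position if $(\mathcal{G}(x),\mathcal{G}^-(x))\in\{(0,1),(1,0)\}$, and tame if $\mathcal{G}(x)=\mathcal{G}^-(x)$. Then $x$ is neither swap nor tame if and only if $x_1$ is odd, $x_1\neq 1$, and $x_1+x_2=x_3+1$. Under these conditions, $x$ has $(\mathcal{G}(x),\mathcal{G}^-(x))=(0,3)$ (resp. $(1,2)$) if and only if $x_2$ is even (resp. odd).
   Context: $\mathcal{G}$ and $\mathcal{G}^-$ are defined by the standard Sprague-Grundy recursion, initialized by $\mathcal{G}=0$ and $\mathcal{G}^-=1$ on terminal positions. -}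

module Defs where

open import Data.Nat using (ℕ; zero; suc; _≟_)
open import Data.List using (List; []; _∷_; length)
open import Data.Product using (_×_; _,_)
open import Relation.Nullary.Decidable using (does)
open import Data.Bool using (Bool; true; false; if_then_else_; _∨_)

elem : ℕ → List ℕ → Bool
elem n []       = false
elem n (m ∷ ms) = does (n ≟ m) ∨ elem n ms

-- mex: least natural number not occurring in the list.
-- The answer is at most the length of the list, so fuel = length suffices.
mexGo : ℕ → ℕ → List ℕ → ℕ
mexGo zero    n l = n
mexGo (suc k) n l = if elem n l then mexGo k (suc n) l else n

mex : List ℕ → ℕ
mex l = mexGo (length l) 0 l

-- Sprague-Grundy function of Slow Exact 2-Nim on three piles (a , b , c),
-- with value t on terminal positions (t = 0: normal play, t = 1: misère).
mutual
  SG : ℕ → ℕ → ℕ → ℕ → ℕ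
  SG t a b c with opts t a b c
  ... | []         = t
  ... | o@(_ ∷ _)  = mex o

  opts : ℕ → ℕ → ℕ → ℕ → List ℕ
  opts t zero    zero    zero    = []
  opts t zero    zero    (suc c) = []
  opts t zero    (suc b) zero    = []
  opts t (suc a) zero    zero    = []
  opts t zero    (suc b) (suc c) = SG t zero b c ∷ []
  opts t (suc a) zero    (suc c) = SG t a zero c ∷ []
  opts t (suc a) (suc b) zero    = SG t a b zero ∷ []
  opts t (suc a) (suc b) (suc c) =
    SG t a b (suc c) ∷ SG t a (suc b) c ∷ SG t (suc a) b c ∷ []

G : ℕ → ℕ → ℕ → ℕ
G = SG 0

G⁻ : ℕ → ℕ → ℕ → ℕ
G⁻ = SG 1

GG : ℕ → ℕ → ℕ → ℕ × ℕ
GG a b c = G a b c , G⁻ a b c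

module Submission where

-- Slow Exact 2-Nim on three piles.  Positions are written canonically as
-- (a , a + p , a + p + d).  The proof rests on a closed formula:
--
--   (𝒢 , 𝒢⁻)(a , a + p , a + p + d) = flipPow p (table a d),
--
-- where  table a d  is the value pair on the "diagonal" (a , a , a + d) and
-- flipPow p applies the involution 0 ↔ 1, 2 ↔ 3 to both entries when p is odd.
--
-- Next the table is classified: its entries are
-- swap or tame pairs (a class closed under the flip), except at the
-- exceptional diagonal points (a odd, a ≠ 1, a = d + 1), where the entry is
-- (1 , 2).

open import Defs
open import Data.Nat using (ℕ; zero; suc; _≤_; _+_; _%_; _≟_)
open import Data.Nat.Properties using (+-suc; +-identityʳ; +-comm; +-assoc; +-cancelˡ-≡; m≤n⇒∃[o]m+o≡n)
open import Data.Nat.DivMod using (%-distribˡ-+)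
open import Data.Bool using (_∨_; if_then_else_)
open import Data.Bool.Properties using (∨-assoc; ∨-comm)
open import Data.List using (List; []; _∷_; map)
open import Data.Product using (_×_; _,_; proj₁; proj₂; map₂)
open import Data.Sum as Sum using (_⊎_; inj₁; inj₂)
open import Data.Empty using (⊥-elim)
open import Relation.Binary.PropositionalEquality using (_≡_; _≢_; refl; sym; trans; cong; cong₂)
open import Relation.Nullary using (¬_; yes; no)
open import Relation.Nullary.Decidable using (Dec; does; _×-dec_; ¬?)
open import Function.Base using (_∘_)
open import Function.Bundles using (_⇔_; mk⇔; Equivalence)
open Equivalence using (to; from)

open Relation.Binary.PropositionalEquality.≡-Reasoning

cong-[_,_,_] : ∀ {A : Set} {x x′ y y′ z z′ : A} → x ≡ x′ → y ≡ y′ → z ≡ z′ →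
               x ∷ y ∷ z ∷ [] ≡ x′ ∷ y′ ∷ z′ ∷ []
cong-[ refl , refl , refl ] = refl

mexGo-cong : ∀ k n (l l′ : List ℕ) → (∀ m → elem m l ≡ elem m l′) → mexGo k n l ≡ mexGo k n l′
mexGo-cong zero    n l l′ same = refl
mexGo-cong (suc k) n l l′ same =
  cong₂ (λ occurs rest → if occurs then rest else n) (same n) (mexGo-cong k (suc n) l l′ same)

elem-swap : ∀ m x y l → elem m (x ∷ y ∷ l) ≡ elem m (y ∷ x ∷ l)
elem-swap m x y l = begin
  does (m ≟ x) ∨ (does (m ≟ y) ∨ elem m l)  ≡⟨ sym (∨-assoc (does (m ≟ x)) _ _) ⟩
  (does (m ≟ x) ∨ does (m ≟ y)) ∨ elem m l  ≡⟨ cong (_∨ elem m l) (∨-comm (does (m ≟ x)) _) ⟩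
  (does (m ≟ y) ∨ does (m ≟ x)) ∨ elem m l  ≡⟨ ∨-assoc (does (m ≟ y)) _ _ ⟩
  does (m ≟ y) ∨ (does (m ≟ x) ∨ elem m l)  ∎

mex-swap₁₂ : ∀ x y z → mex (x ∷ y ∷ z ∷ []) ≡ mex (y ∷ x ∷ z ∷ [])
mex-swap₁₂ x y z = mexGo-cong 3 0 (x ∷ y ∷ z ∷ []) (y ∷ x ∷ z ∷ []) (λ m → elem-swap m x y (z ∷ []))

mex-swap₂₃ : ∀ x y z → mex (x ∷ y ∷ z ∷ []) ≡ mex (x ∷ z ∷ y ∷ [])
mex-swap₂₃ x y z = mexGo-cong 3 0 (x ∷ y ∷ z ∷ []) (x ∷ z ∷ y ∷ []) (λ m → cong (does (m ≟ x) ∨_) (elem-swap m y z []))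

-- SG is symmetric in the piles: the moves of (a , b , c) and (b , a , c)
-- (resp. (a , c , b)) correspond, so their option lists agree up to order.
SG-swap₁₂ : ∀ t a b c → SG t a b c ≡ SG t b a c
SG-swap₁₂ t zero    zero    c       = refl
SG-swap₁₂ t zero    (suc b) zero    = refl
SG-swap₁₂ t (suc a) zero    zero    = refl
SG-swap₁₂ t zero    (suc b) (suc c) = cong (λ v → mex (v ∷ [])) (SG-swap₁₂ t zero b c)
SG-swap₁₂ t (suc a) zero    (suc c) = cong (λ v → mex (v ∷ [])) (SG-swap₁₂ t a zero c)
SG-swap₁₂ t (suc a) (suc b) zero    = cong (λ v → mex (v ∷ [])) (SG-swap₁₂ t a b zero)
SG-swap₁₂ t (suc a) (suc b) (suc c) =
  trans (mex-swap₂₃ (SG t a b (suc c)) (SG t a (suc b) c) (SG t (suc a) b c))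
        (cong mex cong-[ SG-swap₁₂ t a b (suc c) , SG-swap₁₂ t (suc a) b c , SG-swap₁₂ t a (suc b) c ])

SG-swap₂₃ : ∀ t a b c → SG t a b c ≡ SG t a c b
SG-swap₂₃ t zero    zero    zero    = refl
SG-swap₂₃ t zero    zero    (suc c) = refl
SG-swap₂₃ t zero    (suc b) zero    = refl
SG-swap₂₃ t (suc a) zero    zero    = refl
SG-swap₂₃ t zero    (suc b) (suc c) = cong (λ v → mex (v ∷ [])) (SG-swap₂₃ t zero b c)
SG-swap₂₃ t (suc a) zero    (suc c) = cong (λ v → mex (v ∷ [])) (SG-swap₂₃ t a zero c)
SG-swap₂₃ t (suc a) (suc b) zero    = cong (λ v → mex (v ∷ [])) (SG-swap₂₃ t a b zero)
SG-swap₂₃ t (suc a) (suc b) (suc c) =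
  trans (mex-swap₁₂ (SG t a b (suc c)) (SG t a (suc b) c) (SG t (suc a) b c))
        (cong mex cong-[ SG-swap₂₃ t a (suc b) c , SG-swap₂₃ t a b (suc c) , SG-swap₂₃ t (suc a) b c ])

GG-swap₁₂ : ∀ a b c → GG a b c ≡ GG b a c
GG-swap₁₂ a b c = cong₂ _,_ (SG-swap₁₂ 0 a b c) (SG-swap₁₂ 1 a b c)

GG-swap₂₃ : ∀ a b c → GG a b c ≡ GG a c b
GG-swap₂₃ a b c = cong₂ _,_ (SG-swap₂₃ 0 a b c) (SG-swap₂₃ 1 a b c)

-- Componentwise mex of value pairs: GG of a non-terminal position is the
-- mexPair of the GG values of its options (definitionally).
mexPair : List (ℕ × ℕ) → ℕ × ℕ
mexPair l = mex (map proj₁ l) , mex (map proj₂ l)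

flip : ℕ → ℕ
flip 0 = 1
flip 1 = 0
flip 2 = 3
flip 3 = 2
flip n = n

flip² : ℕ × ℕ → ℕ × ℕ
flip² (x , y) = flip x , flip y

flipPow : ℕ → ℕ × ℕ → ℕ × ℕ
flipPow zero          v = v
flipPow (suc zero)    v = flip² v
flipPow (suc (suc p)) v = flipPow p v

-- The value pair of the diagonal position (a , a , a + d).  Away from the
-- borders a ≤ 1 and d ≤ 1 it is invariant under (a , d) ↦ (a + 2 , d + 2);
-- along d = 0 and d = 1 (the sequences row₀ a = table (a + 2) 0 and
-- row₁ a = table (a + 2) 1) it is 4-periodic in a.
row₀ : ℕ → ℕ × ℕ
row₀ 0 = 0 , 0
row₀ 1 = 0 , 1
row₀ 2 = 0 , 0
row₀ 3 = 1 , 0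
row₀ (suc (suc (suc (suc a)))) = row₀ a

row₁ : ℕ → ℕ × ℕ
row₁ 0 = 1 , 0
row₁ 1 = 2 , 2
row₁ 2 = 0 , 1
row₁ 3 = 2 , 2
row₁ (suc (suc (suc (suc a)))) = row₁ a

table : ℕ → ℕ → ℕ × ℕ
table zero          d                   = 0 , 1
table (suc zero)    zero                = 1 , 0
table (suc zero)    (suc d)             = 2 , 2
table (suc (suc a)) zero                = row₀ a
table (suc (suc a)) (suc zero)          = row₁ a
table 2             (suc (suc d))       = 0 , 0
table 3             (suc (suc zero))    = 1 , 2
table 3             (suc (suc (suc d))) = 2 , 2
table (suc (suc (suc (suc a)))) (suc (suc d)) = table (suc (suc a)) d

value : ℕ → ℕ → ℕ → ℕ × ℕ
value a p d = flipPow p (table a d)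

position : ℕ → ℕ → ℕ → ℕ × ℕ
position a p d = GG a (a + p) (a + p + d)

-- The options of (A + 1 , A + 1 + p , A + 1 + p + d), in canonical
-- coordinates, evaluated by f : (a , p , d) ↦ value pair.  They arise from
-- removing a token from piles {1,2}, {1,3} and {2,3} respectively.
Evaluation : Set
Evaluation = ℕ → ℕ → ℕ → ℕ × ℕ

secondOption : Evaluation → ℕ → ℕ → ℕ → ℕ × ℕ
secondOption f A p zero    = f A p 1
secondOption f A p (suc d) = f A (suc p) d

thirdOption : Evaluation → ℕ → ℕ → ℕ → ℕ × ℕ
thirdOption f A (suc q) d       = f (suc A) q d
thirdOption f A zero    zero    = f A 0 1
thirdOption f A zero    (suc d) = f A 1 d

options : Evaluation → ℕ → ℕ → ℕ → List (ℕ × ℕ)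
options f A p d = f A p (suc d) ∷ secondOption f A p d ∷ thirdOption f A p d ∷ []

middle-suc : ∀ a′ A q d → GG a′ (A + suc q) (A + suc q + d) ≡ GG a′ (suc (A + q)) (suc (A + q + d))
middle-suc a′ A q d rewrite +-suc A q = refl

-- The options of (A + 1 , A + 1 + p , A + 1 + p + d) are, after sorting the
-- piles (using the symmetry of SG), exactly the canonical positions listed by
-- options.
position-step : ∀ A p d → position (suc A) p d ≡ mexPair (options position A p d)
position-step A p d = cong mexPair cong-[ first , second p d , third p d ]
  where
  first : GG A (A + p) (suc (A + p + d)) ≡ position A p (suc d)
  first = cong (GG A (A + p)) (sym (+-suc (A + p) d))

  second : ∀ p d → GG A (suc (A + p)) (A + p + d) ≡ secondOption position A p d
  second p zero    rewrite +-identityʳ (A + p) | +-comm (A + p) 1 = GG-swap₂₃ A (suc (A + p)) (A + p)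
  second p (suc d) rewrite +-suc (A + p) d = sym (middle-suc A A p d)

  third : ∀ p d → GG (suc A) (A + p) (A + p + d) ≡ thirdOption position A p d
  third (suc q) d       = middle-suc (suc A) A q d
  third zero    zero    rewrite +-identityʳ (A + 0) | +-identityʳ A | +-comm A 1 =
    trans (GG-swap₁₂ (suc A) A A) (GG-swap₂₃ A (suc A) A)
  third zero    (suc d) rewrite +-identityʳ A | +-suc A d | +-comm A 1 = GG-swap₁₂ (suc A) A (suc (A + d))

Recurrence : ℕ → ℕ → ℕ → Set
Recurrence A p d = mexPair (options value A p d) ≡ value (suc A) p d

-- Both sides
-- are periodic in (A , d) with the periods of the table, so finitely many
-- instances (each checked by evaluation) cover all (A , d).
LocalRecurrence : ℕ → ℕ → Set
LocalRecurrence A d = Recurrence A 0 d × Recurrence A 1 d × Recurrence A 2 d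

pattern verified = refl , refl , refl

local-recurrence : ∀ A d → LocalRecurrence A d
local-recurrence 0 0 = verified
local-recurrence 0 (suc d) = verified
local-recurrence 1 0 = verified
local-recurrence 1 1 = verified
local-recurrence 1 (suc (suc d)) = verified
local-recurrence 2 0 = verified
local-recurrence 3 0 = verified
local-recurrence 4 0 = verified
local-recurrence 5 0 = verified
local-recurrence (suc (suc (suc (suc (suc (suc A)))))) 0 = local-recurrence (suc (suc A)) 0
local-recurrence 2 1 = verified
local-recurrence 3 1 = verified
local-recurrence 4 1 = verified
local-recurrence 5 1 = verified
local-recurrence 6 1 = verified
local-recurrence 7 1 = verified
local-recurrence (suc (suc (suc (suc (suc (suc (suc (suc A)))))))) 1 = local-recurrence (suc (suc (suc (suc A)))) 1
local-recurrence 2 2 = verified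
local-recurrence 3 2 = verified
local-recurrence 4 2 = verified
local-recurrence 5 2 = verified
local-recurrence 6 2 = verified
local-recurrence 7 2 = verified
local-recurrence (suc (suc (suc (suc (suc (suc (suc (suc A)))))))) 2 = local-recurrence (suc (suc (suc (suc A)))) 2
local-recurrence 2 (suc (suc (suc d))) = verified
local-recurrence 3 3 = verified
local-recurrence 3 (suc (suc (suc (suc d)))) = verified
local-recurrence (suc (suc (suc (suc A)))) (suc (suc (suc d))) = local-recurrence (suc (suc A)) (suc d)

-- For p ≥ 1 the recurrence at p + 2 is literally the one at p, since all
-- flips involved depend only on parity; so p ∈ {0, 1, 2} suffices.
recurrence : ∀ A p d → Recurrence A p d
recurrence A zero                d = proj₁ (local-recurrence A d)
recurrence A (suc zero)          d = proj₁ (proj₂ (local-recurrence A d))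
recurrence A (suc (suc zero))    d = proj₂ (proj₂ (local-recurrence A d))
recurrence A (suc (suc (suc q))) zero    = recurrence A (suc q) zero
recurrence A (suc (suc (suc q))) (suc d) = recurrence A (suc q) (suc d)

-- Row 0 recurrence: (0 , p + 1 , p + 1 + d) has the single option
-- (0 , p , p + d), so the values alternate between (0 , 1) and (1 , 0).
border-recurrence : ∀ p → mexPair (flipPow p (0 , 1) ∷ []) ≡ flipPow (suc p) (0 , 1)
border-recurrence zero          = refl
border-recurrence (suc zero)    = refl
border-recurrence (suc (suc p)) = border-recurrence p

RowCorrect : ℕ → Set
RowCorrect a = ∀ p d → position a p d ≡ value a p d

row-zero : RowCorrect 0
row-zero zero    zero    = refl
row-zero zero    (suc d) = refl
row-zero (suc p) d       =
  trans (cong (λ v → mexPair (v ∷ [])) (row-zero p d)) (border-recurrence p)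

-- Row A + 1 from row A, by induction on p: every option lies in row A or
-- in row A + 1 with a smaller p.
row-step : ∀ A → RowCorrect A → RowCorrect (suc A)
row-step A previous p d = begin
  position (suc A) p d             ≡⟨ position-step A p d ⟩
  mexPair (options position A p d) ≡⟨ cong mexPair cong-[ previous p (suc d) , second p d , third p d ] ⟩
  mexPair (options value A p d)    ≡⟨ recurrence A p d ⟩
  value (suc A) p d                ∎
  where
  second : ∀ p d → secondOption position A p d ≡ secondOption value A p d
  second p zero    = previous p 1
  second p (suc d) = previous (suc p) d

  third : ∀ p d → thirdOption position A p d ≡ thirdOption value A p d
  third (suc q) d       = row-step A previous q d
  third zero    zero    = previous 0 1
  third zero    (suc d) = previous 1 d

closed-form : ∀ a → RowCorrect a
closed-form zero    = row-zero
closed-form (suc A) = row-step A (closed-form A)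

-- Pairs that are swap ((0 , 1) or (1 , 0)) or tame (equal entries).  The
-- class is closed under the flip, so it passes from the table to all positions.
data SwapOrTame : ℕ × ℕ → Set where
  swap₀₁ : SwapOrTame (0 , 1)
  swap₁₀ : SwapOrTame (1 , 0)
  tame   : ∀ n → SwapOrTame (n , n)

flipPow-swapOrTame : ∀ {v} → SwapOrTame v → ∀ p → SwapOrTame (flipPow p v)
flipPow-swapOrTame s        zero          = s
flipPow-swapOrTame swap₀₁   (suc zero)    = swap₁₀
flipPow-swapOrTame swap₁₀   (suc zero)    = swap₀₁
flipPow-swapOrTame (tame n) (suc zero)    = tame (flip n)
flipPow-swapOrTame s        (suc (suc p)) = flipPow-swapOrTame s p

row₀-swapOrTame : ∀ a → SwapOrTame (row₀ a)
row₀-swapOrTame 0 = tame 0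
row₀-swapOrTame 1 = swap₀₁
row₀-swapOrTame 2 = tame 0
row₀-swapOrTame 3 = swap₁₀
row₀-swapOrTame (suc (suc (suc (suc a)))) = row₀-swapOrTame a

row₁-swapOrTame : ∀ a → SwapOrTame (row₁ a)
row₁-swapOrTame 0 = swap₁₀
row₁-swapOrTame 1 = tame 2
row₁-swapOrTame 2 = swap₀₁
row₁-swapOrTame 3 = tame 2
row₁-swapOrTame (suc (suc (suc (suc a)))) = row₁-swapOrTame a

Exceptional : ℕ → ℕ → Set
Exceptional a d = a % 2 ≡ 1 × a ≢ 1 × a ≡ suc d

exceptional? : ∀ a d → Dec (Exceptional a d)
exceptional? a d = (a % 2 ≟ 1) ×-dec (¬? (a ≟ 1) ×-dec (a ≟ suc d))

exceptional-table : ∀ a d → Exceptional a d → table a d ≡ (1 , 2)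
exceptional-table 0 d (() , _)
exceptional-table 1 d (_ , a≢1 , _) = ⊥-elim (a≢1 refl)
exceptional-table 2 d (() , _)
exceptional-table 3 .2 (_ , _ , refl) = refl
exceptional-table (suc (suc (suc (suc a)))) .(suc (suc (suc a))) (odd , _ , refl) =
  exceptional-table (suc (suc a)) (suc a) (odd , (λ ()) , refl)

regular-table : ∀ a d → ¬ Exceptional a d → SwapOrTame (table a d)
regular-table zero          d             _ = swap₀₁
regular-table (suc zero)    zero          _ = swap₁₀
regular-table (suc zero)    (suc d)       _ = tame 2
regular-table (suc (suc a)) zero          _ = row₀-swapOrTame a
regular-table (suc (suc a)) (suc zero)    _ = row₁-swapOrTame a
regular-table 2             (suc (suc d)) _ = tame 0
regular-table 3             (suc (suc zero))    regular = ⊥-elim (regular (refl , (λ ()) , refl))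
regular-table 3             (suc (suc (suc d))) _ = tame 2
regular-table (suc (suc (suc (suc a)))) (suc (suc d)) regular =
  regular-table (suc (suc a)) d (λ { (odd , _ , eq) → regular (odd , (λ ()) , cong (λ n → suc (suc n)) eq) })

flipPow-exceptional : ∀ a p → a % 2 ≡ 1 →
  (flipPow p (1 , 2) ≡ (1 , 2) × (a + p) % 2 ≡ 1) ⊎ (flipPow p (1 , 2) ≡ (0 , 3) × (a + p) % 2 ≡ 0)
flipPow-exceptional a p odd = Sum.map (map₂ (trans shift)) (map₂ (trans shift)) (by-parity p)
  where
  shift : (a + p) % 2 ≡ (1 + p % 2) % 2
  shift = trans (%-distribˡ-+ a p 2) (cong (λ r → (r + p % 2) % 2) odd)

  by-parity : ∀ p → (flipPow p (1 , 2) ≡ (1 , 2) × (1 + p % 2) % 2 ≡ 1)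
                 ⊎ (flipPow p (1 , 2) ≡ (0 , 3) × (1 + p % 2) % 2 ≡ 0)
  by-parity zero          = inj₁ (refl , refl)
  by-parity (suc zero)    = inj₂ (refl , refl)
  by-parity (suc (suc p)) = by-parity p

Swap : ℕ × ℕ → Set
Swap v = v ≡ (0 , 1) ⊎ v ≡ (1 , 0)

Tame : ℕ × ℕ → Set
Tame v = proj₁ v ≡ proj₂ v

Wild : ℕ × ℕ → Set
Wild v = ¬ Swap v × ¬ Tame v

swapOrTame-not-wild : ∀ {v} → SwapOrTame v → ¬ Wild v
swapOrTame-not-wild swap₀₁   (¬swap , _) = ¬swap (inj₁ refl)
swapOrTame-not-wild swap₁₀   (¬swap , _) = ¬swap (inj₂ refl)
swapOrTame-not-wild (tame n) (_ , ¬tame) = ¬tame refl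

exceptional-values-wild : ∀ {v} → v ≡ (1 , 2) ⊎ v ≡ (0 , 3) → Wild v
exceptional-values-wild (inj₁ refl) = (λ { (inj₁ ()) ; (inj₂ ()) }) , (λ ())
exceptional-values-wild (inj₂ refl) = (λ { (inj₁ ()) ; (inj₂ ()) }) , (λ ())

exceptional-position : ∀ a p d → Exceptional a d →
  (position a p d ≡ (1 , 2) × (a + p) % 2 ≡ 1) ⊎ (position a p d ≡ (0 , 3) × (a + p) % 2 ≡ 0)
exceptional-position a p d exceptional
  rewrite closed-form a p d | exceptional-table a d exceptional = flipPow-exceptional a p (proj₁ exceptional)

regular-position : ∀ a p d → ¬ Exceptional a d → SwapOrTame (position a p d)
regular-position a p d regular rewrite closed-form a p d =
  flipPow-swapOrTame (regular-table a d regular) p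

wild⇔exceptional : ∀ a p d → Wild (position a p d) ⇔ Exceptional a d
wild⇔exceptional a p d = mk⇔ wild⇒exceptional exceptional⇒wild
  where
  wild⇒exceptional : Wild (position a p d) → Exceptional a d
  wild⇒exceptional wild with exceptional? a d
  ... | yes exceptional = exceptional
  ... | no  regular     = ⊥-elim (swapOrTame-not-wild (regular-position a p d regular) wild)

  exceptional⇒wild : Exceptional a d → Wild (position a p d)
  exceptional⇒wild exceptional = exceptional-values-wild
    (Sum.map proj₁ proj₁ (exceptional-position a p d exceptional))

exceptional-parity : ∀ a p d → Exceptional a d →
  (position a p d ≡ (0 , 3) ⇔ (a + p) % 2 ≡ 0) × (position a p d ≡ (1 , 2) ⇔ (a + p) % 2 ≡ 1)
exceptional-parity a p d exceptional with exceptional-position a p d exceptional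
... | inj₁ (value≡ , odd)  rewrite value≡ | odd  = mk⇔ (λ ()) (λ ()) , mk⇔ (λ _ → refl) (λ _ → refl)
... | inj₂ (value≡ , even) rewrite value≡ | even = mk⇔ (λ _ → refl) (λ _ → refl) , mk⇔ (λ ()) (λ ())

-- The condition of the corollary, in canonical coordinates, says that the
-- diagonal point is exceptional: x₁ + x₂ = x₃ + 1 means a = d + 1.
condition⇔exceptional : ∀ a m d →
  (a % 2 ≡ 1 × a ≢ 1 × a + m ≡ m + d + 1) ⇔ Exceptional a d
condition⇔exceptional a m d =
  mk⇔ (λ (odd , a≢1 , sum) → odd , a≢1 , +-cancelˡ-≡ m a (suc d) (trans (+-comm m a) (trans sum move)))
      (λ (odd , a≢1 , a≡) → odd , a≢1 , trans (+-comm a m) (trans (cong (m +_) a≡) (sym move)))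
  where
  move : m + d + 1 ≡ m + suc d
  move = trans (+-assoc m d 1) (cong (m +_) (+-comm d 1))

-- Writing x = (a , a + p , a + p + d), both the wildness of x and the
-- condition of the corollary mean that (a , d) is exceptional; there the
-- value pair is determined by the parity of x₂ = a + p.
corollary4 : (x₁ x₂ x₃ : ℕ) → x₁ ≤ x₂ → x₂ ≤ x₃ →
    ((¬ (GG x₁ x₂ x₃ ≡ (0 , 1) ⊎ GG x₁ x₂ x₃ ≡ (1 , 0)) × ¬ (G x₁ x₂ x₃ ≡ G⁻ x₁ x₂ x₃))
      ⇔ (x₁ % 2 ≡ 1 × x₁ ≢ 1 × x₁ + x₂ ≡ x₃ + 1))
    × ((x₁ % 2 ≡ 1 × x₁ ≢ 1 × x₁ + x₂ ≡ x₃ + 1) →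
        (GG x₁ x₂ x₃ ≡ (0 , 3) ⇔ x₂ % 2 ≡ 0)
        × (GG x₁ x₂ x₃ ≡ (1 , 2) ⇔ x₂ % 2 ≡ 1))
corollary4 x₁ x₂ x₃ x₁≤x₂ x₂≤x₃ with m≤n⇒∃[o]m+o≡n x₁≤x₂ | m≤n⇒∃[o]m+o≡n x₂≤x₃
... | p , refl | d , refl =
  mk⇔ (from condition ∘ to wild) (from wild ∘ to condition) ,
  exceptional-parity x₁ p d ∘ to condition
  where
  wild : Wild (position x₁ p d) ⇔ Exceptional x₁ d
  wild = wild⇔exceptional x₁ p d

  condition : (x₁ % 2 ≡ 1 × x₁ ≢ 1 × x₁ + (x₁ + p) ≡ x₁ + p + d + 1) ⇔ Exceptional x₁ d
  condition = condition⇔exceptional x₁ (x₁ + p) d
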